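{- Let $T^*$ be an optimal solution of a UFP instance satisfying the standing assumptions below, let $k\ge2$ be an even integer, and let $\mathcal{D}$ be the tree constructed below from $\tilde L_R$ and $k$. If $S'\subseteq\tilde L_R$ is a segment cover, then $S'$ is $2k$-thin for $\tilde L_R$.
   Context: A UFP instance: a path with vertices $1,\dots,n$ from left to right, edges $e=(v,v+1)$ with capacities $u_e\in\mathbb{Z}_{>0}$, and a finite set $T$ of tasks labelled by distinct integers $1,\dots,|T|$; each task $i$ has a subpath $P(i)$ from $s(i)$ to $t(i)$, demand $d(i)>0$, profit $w(i)\ge0$. Feasible sets respect all capacities; $T^*$ is a feasible set of maximum profit. $b(i)=\min_{e\in P(i)}u_e$, $e(i)$ the edge of $P(i)$ with capacity $b(i)$. Standing assumptions: edge capacities pairwise distinct, $d(i)\le b(i)$, every vertex is start or end vertex of exactly one task. Segments: if $e(i)=(v,v+1)$, $\tilde\ell_R(i)=(1,t(i))\times\{b(i)+Mv+\frac{i}{|T|+1}\}$ with $M=1+\max_e u_e$, weight $w(i)$; $\tilde L_R=\{\tilde\ell_R(i): i\in T^*\}$. A segment $(a,b)\times\{y\}$ contains edge $(v,v+1)$ if $a\le v$ and $v+1\le b$. A vertical segment $\{x\}\times(y_b,y_t)$ intersects $(a,b)\times\{y\}$ if $a<x<b$ and $y_b<y<y_t$. $S'\subseteq\tilde L_R$ is $2k$-thin for $\tilde L_R$ if every vertical segment intersecting more than $2k$ segments of $\tilde L_R$ intersects a segment of $S'$. Tree $\mathcal{D}$: a rooted directed out-tree whose nodes $w$ carry labels $(e_w,I_w,R_w)$,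 $e_w$ an edge, $I_w\subseteq[0,\infty)$ an interval, $R_w$ the set of segments of $\tilde L_R$ containing $e_w$ with $y$-coordinate in $I_w$. If no edge is contained in at least $k-1$ segments, $\mathcal D$ has no nodes. Otherwise let $e_r$ be the rightmost edge contained in at least $k-1$ segments; the root has label $(e_r,[0,\infty),R_r)$. For a node $w$: if $e_w=(1,2)$, $w$ is a leaf. Otherwise let $e'$ be the edge immediately left of $e_w$ and $R'$ the segments containing $e'$ with $y$-coordinate in $I_w$. If $|R'|<k$, $w$ gets one child with label $(e',I_w,R')$. Otherwise, sort $R'$ by increasing $y$-coordinate $y_1<y_2<\dots$, let $R_b$ be the first $k/2$ and $R_t$ the remaining ones, choose $y_0$ with $y_{k/2}<y_0\le y_{k/2+1}$, and give $w$ two children labelled $(e',I_w\cap[0,y_0),R_b)$ and $(e',I_w\cap[y_0,\infty),R_t)$. A segment cover is a set $S'\subseteq\tilde L_R$ with $S'\cap R_w\ne\emptyset$ for every node $w$ of $\mathcal D$.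
   Formalization: The demands $d(i)$ and profits $w(i)$ are rational, and the vertical segments and the split points $y_0$ are taken with rational coordinates. -}

module Defs where

open import Data.Bool using (Bool; true; false; _∧_; if_then_else_)
open import Data.Nat as ℕ using (ℕ; zero; suc; _+_; _*_; _∸_; _≤_; _<_; _⊔_; ⌊_/2⌋)
open import Data.Nat.Properties using (_≤?_)
open import Data.Fin using (Fin; toℕ) renaming (zero to fz; suc to fs)
open import Data.Integer using (+_)
open import Data.Rational as ℚ using (ℚ; 0ℚ)
open import Data.Rational.Properties as ℚP using ()
open import Data.Product using (Σ; _×_; ∃)
open import Data.Sum using (_⊎_)
open import Relation.Binary.PropositionalEquality using (_≡_)
open import Relation.Nullary.Decidable using (⌊_⌋; yes; no)
open import Data.Unit using (⊤)

count : ∀ {N} → (Fin N → Bool) → ℕ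
count {zero}  f = 0
count {suc N} f = (if f fz then 1 else 0) + count (λ i → f (fs i))

sumℚ : ∀ {N} → (Fin N → ℚ) → ℚ
sumℚ {zero}  f = 0ℚ
sumℚ {suc N} f = f fz ℚ.+ sumℚ (λ i → f (fs i))

ℕ→ℚ : ℕ → ℚ
ℕ→ℚ m = (+ m) ℚ./ 1

_<ℚᵇ_ : ℚ → ℚ → Bool
p <ℚᵇ q = ⌊ p ℚP.<? q ⌋

_≤ℚᵇ_ : ℚ → ℚ → Bool
p ≤ℚᵇ q = ⌊ p ℚP.≤? q ⌋

_≤ᵇ_ : ℕ → ℕ → Bool
m ≤ᵇ n = ⌊ m ≤? n ⌋

-- UFP instances on a path with vertices 1..n.
-- Edge (v,v+1) is identified with the natural number v (1 ≤ v < n);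
-- u v is its capacity.  Tasks are Fin N; task i has label toℕ i + 1.

record UFP : Set where
  field
    n    : ℕ
    u    : ℕ → ℕ
    N    : ℕ
    s t  : Fin N → ℕ
    d w  : Fin N → ℚ
    u-pos   : ∀ v → 1 ≤ v → v < n → 0 < u v
    s-ge1   : ∀ i → 1 ≤ s i
    s<t     : ∀ i → s i < t i
    t-le-n  : ∀ i → t i ≤ n
    d-pos   : ∀ i → 0ℚ ℚ.< d i
    w-nonneg : ∀ i → 0ℚ ℚ.≤ w i

module _ (I : UFP) where
  open UFP I

  onPath : Fin N → ℕ → Bool
  onPath i v = (s i ≤ᵇ v) ∧ (suc v ≤ᵇ t i)

  -- sets of tasks are Bool-valued predicates on Fin N
  Feasible : (Fin N → Bool) → Set
  Feasible S = ∀ v → 1 ≤ v → v < n →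
    sumℚ (λ i → if S i ∧ onPath i v then d i else 0ℚ) ℚ.≤ ℕ→ℚ (u v)

  profit : (Fin N → Bool) → ℚ
  profit S = sumℚ (λ i → if S i then w i else 0ℚ)

  Optimal : (Fin N → Bool) → Set
  Optimal T* = Feasible T* × (∀ S → Feasible S → profit S ℚ.≤ profit T*)

argminFrom : (ℕ → ℕ) → ℕ → ℕ → ℕ
argminFrom u a zero    = a
argminFrom u a (suc l) with u a ≤? u (argminFrom u (suc a) l)
... | yes _ = a
... | no  _ = argminFrom u (suc a) l

maxCap : (ℕ → ℕ) → ℕ → ℕ
maxCap u zero    = 0
maxCap u (suc m) = maxCap u m ⊔ u (suc m)

module _ (I : UFP) where
  open UFP I

  eTask : Fin N → ℕ
  eTask i = argminFrom u (s i) (t i ∸ s i ∸ 1)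

  bTask : Fin N → ℕ
  bTask i = u (eTask i)

  Mconst : ℕ
  Mconst = 1 + maxCap u (n ∸ 1)

  ycoord : Fin N → ℚ
  ycoord i = ℕ→ℚ (bTask i + Mconst * eTask i) ℚ.+ ((+ (toℕ i + 1)) ℚ./ suc N)

  Standing : Set
  Standing =
      (∀ v v' → 1 ≤ v → v < n → 1 ≤ v' → v' < n → u v ≡ u v' → v ≡ v')
    × (∀ i → d i ℚ.≤ ℕ→ℚ (bTask i))
    × (∀ v → 1 ≤ v → v ≤ n →
         Σ (Fin N) (λ i → (s i ≡ v ⊎ t i ≡ v)
           × (∀ j → (s j ≡ v ⊎ t j ≡ v) → j ≡ i)))

  module _ (T* : Fin N → Bool) where

    -- segment ℓ̃_R(i) = (1,t(i)) × {y(i)} contains edge (v,v+1)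
    containsEdge : Fin N → ℕ → Bool
    containsEdge i v = (1 ≤ᵇ v) ∧ (suc v ≤ᵇ t i)

    -- vertical segment {x} × (yb,yt) intersects ℓ̃_R(i)
    hits : ℚ → ℚ → ℚ → Fin N → Bool
    hits x yb yt i = (ℕ→ℚ 1 <ℚᵇ x) ∧ (x <ℚᵇ ℕ→ℚ (t i))
                     ∧ (yb <ℚᵇ ycoord i) ∧ (ycoord i <ℚᵇ yt)

    -- S' ⊆ L̃_R is represented by the set of tasks of T* indexing it
    Thin : ℕ → (Fin N → Bool) → Set
    Thin m S' = ∀ x yb yt →
      m < count (λ i → T* i ∧ hits x yb yt i) →
      Σ (Fin N) (λ i → (S' i ≡ true) × (hits x yb yt i ≡ true))

    -- intervals I_w ⊆ [0,∞) as decidable predicates on y-coordinates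
    Ival : Set
    Ival = ℚ → Bool

    full : Ival
    full y = 0ℚ ≤ℚᵇ y

    _∩below_ : Ival → ℚ → Ival
    (J ∩below y0) y = J y ∧ (0ℚ ≤ℚᵇ y) ∧ (y <ℚᵇ y0)

    _∩above_ : Ival → ℚ → Ival
    (J ∩above y0) y = J y ∧ (y0 ≤ℚᵇ y)

    Rset : ℕ → Ival → Fin N → Bool
    Rset v J i = T* i ∧ containsEdge i v ∧ J (ycoord i)

    -- y0 splits R' (sorted y_1 < y_2 < ...) with y_{k/2} < y0 ≤ y_{k/2+1};
    -- y_m is the element of R' having exactly m-1 elements of R' below it.
    SplitOK : ℕ → ℕ → Ival → ℚ → Set
    SplitOK k v J y0 =
        Σ (Fin N) (λ i → (Rset v J i ≡ true)
            × (suc (count (λ j → Rset v J j ∧ (ycoord j <ℚᵇ ycoord i))) ≡ ⌊ k /2⌋)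
            × (ycoord i ℚ.< y0))
      × Σ (Fin N) (λ i → (Rset v J i ≡ true)
            × (count (λ j → Rset v J j ∧ (ycoord j <ℚᵇ ycoord i)) ≡ ⌊ k /2⌋)
            × (y0 ℚ.≤ ycoord i))

    -- subtree rooted at a node with label (e_w = v, I_w = J, R_w = Rset v J)
    data Tree (k : ℕ) : ℕ → Ival → Set where
      leaf : ∀ {J} → Tree k 1 J
      one  : ∀ {v J} → count (Rset v J) < k →
             Tree k v J → Tree k (suc v) J
      two  : ∀ {v J} (y0 : ℚ) → k ≤ count (Rset v J) → SplitOK k v J y0 →
             Tree k v (J ∩below y0) → Tree k v (J ∩above y0) →
             Tree k (suc v) J

    AllNodes : ∀ {k v J} → (ℕ → Ival → Set) → Tree k v J → Set
    AllNodes {v = v} {J} P leaf = P v J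
    AllNodes {v = v} {J} P (one _ c) = P v J × AllNodes P c
    AllNodes {v = v} {J} P (two _ _ _ c₁ c₂) = P v J × AllNodes P c₁ × AllNodes P c₂

    -- the tree 𝒟 (for a fixed admissible choice of the split points y0)
    data TreeD (k : ℕ) : Set where
      noNodes : (∀ v → 1 ≤ v → v < n → count (Rset v full) < k ∸ 1) → TreeD k
      rooted  : (r : ℕ) → 1 ≤ r → r < n → k ∸ 1 ≤ count (Rset r full) →
                (∀ v → r < v → v < n → count (Rset v full) < k ∸ 1) →
                Tree k r full → TreeD k

    SegmentCover : ∀ {k} → TreeD k → (Fin N → Bool) → Set
    SegmentCover (noNodes _) S' = ⊤
    SegmentCover (rooted _ _ _ _ _ τ) S' =
      AllNodes (λ v J → Σ (Fin N) (λ i → (S' i ≡ true) × (Rset v J i ≡ true))) τ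

-- Let a vertical segment {x} × (yb, yt) meet more than 2k segments of L̃_R and
-- let j be a hit task with t(j) least; with t(j) = v + 1 every hit segment
-- contains the edge v, and a segment through v is hit iff its height lies in
-- the window (yb, yt).  The nodes of 𝒟 at edge v carry at most k - 1 segments
-- each (one more than the sparse edge r + 1 at the root, and at most one more
-- than the parent at every split).  The heart of the proof is an induction on
-- the subtree above edge v: unless some cover element is hit, the hit segments
-- with height in I_w number at most (k - 1) · (ℓ + h), where ℓ (resp. h)
-- records that some segment of R_v below (resp. above) the window shares I_w
-- with a hit; at a split the lower half cannot carry an ℓ-witness of the upper
-- half and vice versa, so ℓ, h ≤ 1 survive.  At the root this gives at most
-- 2(k - 1) < 2k hits, a contradiction.
module Submission where

open import Defs
open import Data.Bool using (Bool; true; false; _∧_; _∨_; if_then_else_)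
open import Data.Bool.Properties using (¬-not)
open import Data.Nat as ℕ using (ℕ; zero; suc; _+_; _*_; _≤_; _<_; z≤n; s≤s; ⌊_/2⌋)
import Data.Nat.Properties as ℕP
open import Algebra.Properties.CommutativeSemigroup ℕP.+-commutativeSemigroup using (interchange)
open import Data.Nat.Coprimality as Coprime using (1-coprimeTo)
open import Data.Fin using (Fin; toℕ) renaming (zero to fz; suc to fs)
open import Data.Fin.Properties using (suc-injective)
open import Data.Integer as ℤ using (+_)
import Data.Integer.Properties as ℤP
open import Data.Rational as ℚ using (ℚ; mkℚ; 0ℚ)
import Data.Rational.Properties as ℚP
open import Data.Product using (∃; _×_; _,_; proj₁; proj₂)
open import Data.Sum using (_⊎_; inj₁; inj₂; [_,_]; map₂)
open import Data.Empty using (⊥; ⊥-elim)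
open import Function using (id)
open import Relation.Nullary using (¬_; Dec; yes; no; contradiction)
open import Relation.Nullary.Decidable using (⌊_⌋)
open import Relation.Binary.PropositionalEquality using (_≡_; refl; sym; trans; cong; cong₂; subst; subst₂)

ind : Bool → ℕ
ind b = if b then 1 else 0

ind≤1 : ∀ b → ind b ≤ 1
ind≤1 true  = ℕP.≤-refl
ind≤1 false = z≤n

∧-elim : ∀ {a b} → a ∧ b ≡ true → a ≡ true × b ≡ true
∧-elim {true} b≡true = refl , b≡true

∧-intro : ∀ {a b} → a ≡ true → b ≡ true → a ∧ b ≡ true
∧-intro refl b≡true = b≡true

false≢true : ∀ {b} {a} {A : Set a} → b ≡ false → b ≡ true → A
false≢true refl ()

∨-elim : ∀ {a b} → a ∨ b ≡ true → a ≡ true ⊎ b ≡ true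
∨-elim {true}  _       = inj₁ refl
∨-elim {false} b≡true = inj₂ b≡true

module _ {p} {P : Set p} where

  from-yes : (P? : Dec P) → ⌊ P? ⌋ ≡ true → P
  from-yes (yes p) _ = p

  to-yes : (P? : Dec P) → P → ⌊ P? ⌋ ≡ true
  to-yes (yes _) _  = refl
  to-yes (no ¬p) p = contradiction p ¬p

ind-mono : ∀ {a b} → (a ≡ true → b ≡ true) → ind a ≤ ind b
ind-mono {false} _   = z≤n
ind-mono {true}  a⇒b rewrite a⇒b refl = ℕP.≤-refl

ind-∧-split : ∀ a {b c d} → ind b ≡ ind c + ind d → ind (a ∧ b) ≡ ind (a ∧ c) + ind (a ∧ d)
ind-∧-split true  split = split
ind-∧-split false _     = refl

ind-cover : ∀ {a b c} → (a ≡ true → b ≡ true ⊎ c ≡ true) → ind a ≤ ind b + ind c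
ind-cover {false} _ = z≤n
ind-cover {true} b∨c with b∨c refl
... | inj₁ refl = s≤s z≤n
... | inj₂ refl = ℕP.m≤n+m 1 _

ind-∨-disjoint : ∀ a b → (a ≡ true → b ≡ true → ⊥) → ind a + ind b ≡ ind (a ∨ b)
ind-∨-disjoint true  true  clash = ⊥-elim (clash refl refl)
ind-∨-disjoint true  false _     = refl
ind-∨-disjoint false _     _     = refl

count-mono : ∀ {N} {f g : Fin N → Bool} → (∀ i → f i ≡ true → g i ≡ true) → count f ≤ count g
count-mono {zero}  _ = z≤n
count-mono {suc N} f⊆g = ℕP.+-mono-≤ (ind-mono (f⊆g fz)) (count-mono (λ i → f⊆g (fs i)))

count-additive : ∀ {N} {f g h : Fin N → Bool} → (∀ i → ind (f i) ≡ ind (g i) + ind (h i)) →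
                 count f ≡ count g + count h
count-additive {zero}  _ = refl
count-additive {suc N} {g = g} {h} split =
  trans (cong₂ _+_ (split fz) (count-additive (λ i → split (fs i))))
        (interchange (ind (g fz)) (ind (h fz)) _ _)

count-subadditive : ∀ {N} {f g h : Fin N → Bool} → (∀ i → ind (f i) ≤ ind (g i) + ind (h i)) →
                    count f ≤ count g + count h
count-subadditive {zero}  _ = z≤n
count-subadditive {suc N} {g = g} {h} cover =
  ℕP.≤-trans (ℕP.+-mono-≤ (cover fz) (count-subadditive (λ i → cover (fs i))))
             (ℕP.≤-reflexive (interchange (ind (g fz)) (ind (h fz)) _ _))

count-none : ∀ {N} {f : Fin N → Bool} → (∀ i → f i ≡ false) → count f ≡ 0
count-none {zero}  _ = refl
count-none {suc N} {f} none rewrite none fz = count-none (λ i → none (fs i))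

count-positive : ∀ {N} {f : Fin N → Bool} i → f i ≡ true → 1 ≤ count f
count-positive {suc N} {f} fz     fi rewrite fi = s≤s z≤n
count-positive {suc N} {f} (fs i) fi = ℕP.≤-trans (count-positive i fi) (ℕP.m≤n+m _ (ind (f fz)))

count-zero-or-witness : ∀ {N} (f : Fin N → Bool) → count f ≡ 0 ⊎ ∃ λ i → f i ≡ true
count-zero-or-witness {zero}  f = inj₁ refl
count-zero-or-witness {suc N} f with f fz in f0
... | true  = inj₂ (fz , f0)
... | false with count-zero-or-witness (λ i → f (fs i))
...   | inj₁ none       = inj₁ none
...   | inj₂ (i , fi) = inj₂ (fs i , fi)

count-unique : ∀ {N} {f : Fin N → Bool} i → (∀ j → f j ≡ true → j ≡ i) → count f ≤ 1
count-unique {suc N} {f} fz only =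
  subst (λ c → ind (f fz) + c ≤ 1) (sym (count-none (λ j → ¬-not (tail j))))
        (ℕP.≤-trans (ℕP.≤-reflexive (ℕP.+-identityʳ _)) (ind≤1 (f fz)))
  where
  tail : ∀ j → f (fs j) ≡ true → ⊥
  tail j fj with () ← only (fs j) fj
count-unique {suc N} {f} (fs i) only with f fz in f0
... | true with () ← only fz f0
... | false = count-unique i (λ j fj → suc-injective (only (fs j) fj))

minimiser : ∀ {N} (f : Fin N → Bool) (g : Fin N → ℕ) →
  (∃ λ j → f j ≡ true × (∀ i → f i ≡ true → g j ≤ g i)) ⊎ (∀ i → f i ≡ false)
minimiser {zero}  f g = inj₂ λ ()
minimiser {suc N} f g with minimiser (λ i → f (fs i)) (λ i → g (fs i)) | f fz in f0
... | inj₂ none | false = inj₂ λ { fz → f0 ; (fs i) → none i }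
... | inj₂ none | true  = inj₁ (fz , f0 , λ { fz _ → ℕP.≤-refl ; (fs i) fi → false≢true (none i) fi })
... | inj₁ (j , fj , least) | false = inj₁ (fs j , fj , λ { fz fi → false≢true f0 fi ; (fs i) fi → least i fi })
... | inj₁ (j , fj , least) | true with g fz ℕP.≤? g (fs j)
...   | yes here = inj₁ (fz , f0 , λ { fz _ → ℕP.≤-refl ; (fs i) fi → ℕP.≤-trans here (least i fi) })
...   | no there = inj₁ (fs j , fj , λ { fz _ → ℕP.<⇒≤ (ℕP.≰⇒> there) ; (fs i) fi → least i fi })

ℕ→ℚ-normal : ∀ m → ℕ→ℚ m ≡ mkℚ (+ m) 0 (Coprime.sym (1-coprimeTo m))
ℕ→ℚ-normal m = ℚP.normalize-coprime (Coprime.sym (1-coprimeTo m))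

ℕ→ℚ-mono : ∀ {m n} → m ≤ n → ℕ→ℚ m ℚ.≤ ℕ→ℚ n
ℕ→ℚ-mono {m} {n} m≤n rewrite ℕ→ℚ-normal m | ℕ→ℚ-normal n =
  ℚ.*≤* (subst₂ ℤ._≤_ (sym (ℤP.*-identityʳ (+ m))) (sym (ℤP.*-identityʳ (+ n))) (ℤ.+≤+ m≤n))

-- All segments lie at non-negative heights, so the interval [0,∞) sees all of them.
ycoord-nonneg : ∀ I i → 0ℚ ℚ.≤ ycoord I i
ycoord-nonneg I i =
  ℚP.nonNegative⁻¹ (level ℚ.+ rank) {{ℚP.nonNeg+nonNeg⇒nonNeg level {{ℚP.normalize-nonNeg base 1}}
                                                         rank {{ℚP.normalize-nonNeg (toℕ i + 1) (suc N)}}}}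
  where
  open UFP I
  base : ℕ
  base = bTask I i + Mconst I * eTask I i
  level rank : ℚ
  level = ℕ→ℚ base
  rank  = (+ (toℕ i + 1)) ℚ./ suc N

module Geometry (I : UFP) (std : Standing I) (T* : Fin (UFP.N I) → Bool) where
  open UFP I

  Y : Fin N → ℚ
  Y = ycoord I

  R : ℕ → Ival I T* → Fin N → Bool
  R = Rset I T*

  lower upper : Ival I T* → ℚ → Ival I T*
  lower = _∩below_ I T*
  upper = _∩above_ I T*

  _⊑_ : Ival I T* → Ival I T* → Set
  J' ⊑ J = ∀ y → J' y ≡ true → J y ≡ true

  lower⇒ : ∀ {J y0 y} → lower J y0 y ≡ true → J y ≡ true × y ℚ.< y0
  lower⇒ {J} {y0} {y} e = proj₁ (∧-elim {J y} e) , from-yes (y ℚP.<? y0) (proj₂ (∧-elim (proj₂ (∧-elim {J y} e))))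

  ⇒lower : ∀ {J y0 y} → J y ≡ true → 0ℚ ℚ.≤ y → y ℚ.< y0 → lower J y0 y ≡ true
  ⇒lower {y0 = y0} {y} Jy 0≤y y<y0 = ∧-intro Jy (∧-intro (to-yes (0ℚ ℚP.≤? y) 0≤y) (to-yes (y ℚP.<? y0) y<y0))

  upper⇒ : ∀ {J y0 y} → upper J y0 y ≡ true → J y ≡ true × y0 ℚ.≤ y
  upper⇒ {J} {y0} {y} e = proj₁ (∧-elim {J y} e) , from-yes (y0 ℚP.≤? y) (proj₂ (∧-elim {J y} e))

  lower⊑ : ∀ J y0 → lower J y0 ⊑ J
  lower⊑ J y0 y e = proj₁ (lower⇒ {J} e)

  upper⊑ : ∀ J y0 → upper J y0 ⊑ J
  upper⊑ J y0 y e = proj₁ (upper⇒ {J} e)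

  interval-split : ∀ J y0 y → 0ℚ ℚ.≤ y → ind (J y) ≡ ind (lower J y0 y) + ind (upper J y0 y)
  interval-split J y0 y 0≤y with J y
  ... | false = refl
  ... | true rewrite to-yes (0ℚ ℚP.≤? y) 0≤y with y ℚP.<? y0 | y0 ℚP.≤? y
  ...   | yes y<y0 | yes y0≤y = ⊥-elim (ℚP.<-irrefl refl (ℚP.<-≤-trans y<y0 y0≤y))
  ...   | yes _    | no _     = refl
  ...   | no _     | yes _    = refl
  ...   | no y≮y0  | no y0≰y  = ⊥-elim (y0≰y (ℚP.≮⇒≥ y≮y0))

  contains⇒ : ∀ {i w} → containsEdge I T* i w ≡ true → 1 ≤ w × suc w ≤ t i
  contains⇒ {i} {w} e = from-yes (1 ℕP.≤? w) (proj₁ (∧-elim e)) , from-yes (suc w ℕP.≤? t i) (proj₂ (∧-elim e))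

  ⇒contains : ∀ {i w} → 1 ≤ w → suc w ≤ t i → containsEdge I T* i w ≡ true
  ⇒contains {i} {w} 1≤w w<t = ∧-intro (to-yes (1 ℕP.≤? w) 1≤w) (to-yes (suc w ℕP.≤? t i) w<t)

  R⇒ : ∀ {w J i} → R w J i ≡ true → T* i ≡ true × containsEdge I T* i w ≡ true × J (Y i) ≡ true
  R⇒ e = let (T*i , rest) = ∧-elim e in T*i , ∧-elim rest

  ⇒R : ∀ w J {i} → T* i ≡ true → containsEdge I T* i w ≡ true → J (Y i) ≡ true → R w J i ≡ true
  ⇒R w J T*i c Ji = ∧-intro T*i (∧-intro c Ji)

  R-narrow : ∀ {w J' J i} → J' ⊑ J → R w J' i ≡ true → R w J i ≡ true
  R-narrow {w} {J'} {J} {i} J'⊑J e = let (T*i , c , J'i) = R⇒ {w} {J'} e in ⇒R w J T*i c (J'⊑J (Y i) J'i)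

  R⇒on-path : ∀ {w J i} → R w J i ≡ true → w < n
  R⇒on-path {w} {J} {i} e = ℕP.≤-trans (proj₂ (contains⇒ (proj₁ (proj₂ (R⇒ {w} {J} e))))) (t-le-n i)

  R-off-path : ∀ {w J} → ¬ (w < n) → count (R w J) ≡ 0
  R-off-path {w} {J} w≮n = count-none {f = R w J} (λ i → ¬-not (λ e → w≮n (R⇒on-path {w} {J} e)))

  R-split : ∀ w J y0 → count (R w J) ≡ count (R w (lower J y0)) + count (R w (upper J y0))
  R-split w J y0 = count-additive λ i →
    ind-∧-split (T* i) (ind-∧-split (containsEdge I T* i w) (interval-split J y0 (Y i) (ycoord-nonneg I i)))

  ends-at-most-once : ∀ w → count (λ i → ⌊ t i ℕP.≟ suc w ⌋) ≤ 1
  ends-at-most-once w with suc w ℕP.≤? n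
  ... | yes w<n =
    let (i , _ , only) = proj₂ (proj₂ std) (suc w) (s≤s z≤n) w<n
    in  count-unique i (λ j e → only j (inj₂ (from-yes (t j ℕP.≟ suc w) e)))
  ... | no w≮n = ℕP.≤-trans (ℕP.≤-reflexive (count-none (λ j → ¬-not (λ e →
                       w≮n (subst (_≤ n) (from-yes (t j ℕP.≟ suc w) e) (t-le-n j)))))) z≤n

  -- Moving one edge to the left adds at most the segment ending there.
  R-step : ∀ w J → count (R w J) ≤ suc (count (R (suc w) J))
  R-step w J = begin
    count (R w J)                              ≤⟨ count-subadditive (λ i → ind-cover (continues-or-ends i)) ⟩
    count (R (suc w) J) + count ends           ≤⟨ ℕP.+-monoʳ-≤ _ (ends-at-most-once w) ⟩
    count (R (suc w) J) + 1                    ≡⟨ ℕP.+-comm _ 1 ⟩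
    suc (count (R (suc w) J))                  ∎
    where
    open ℕP.≤-Reasoning
    ends : Fin N → Bool
    ends i = ⌊ t i ℕP.≟ suc w ⌋
    continues-or-ends : ∀ i → R w J i ≡ true → R (suc w) J i ≡ true ⊎ ends i ≡ true
    continues-or-ends i e =
      let (T*i , c , Ji) = R⇒ {w} {J} e in
      [ (λ w+1<t → inj₁ (⇒R (suc w) J T*i (⇒contains (s≤s z≤n) w+1<t) Ji))
      , (λ w+1≡t → inj₂ (to-yes (t i ℕP.≟ suc w) (sym w+1≡t))) ] (ℕP.m≤n⇒m<n∨m≡n (proj₂ (contains⇒ c)))

  -- The lower child of a split node (k = m + 1) holds fewer than ⌊k/2⌋ ≤ m segments:
  -- all of them lie below the element of rank ⌊k/2⌋ + 1.
  lower-child-bound : ∀ {m w J y0} → SplitOK I T* (suc m) w J y0 → count (R w (lower J y0)) ≤ m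
  lower-child-bound {m} {w} {J} {y0} (_ , (i , _ , rank , y0≤Yi)) = begin
    count (R w (lower J y0))                        ≤⟨ count-mono below-i ⟩
    count (λ j → R w J j ∧ (Y j <ℚᵇ Y i))           ≡⟨ rank ⟩
    ⌊ suc m /2⌋                                     ≤⟨ ℕP.≤-pred (ℕP.⌊n/2⌋<n m) ⟩
    m                                               ∎
    where
    open ℕP.≤-Reasoning
    below-i : ∀ j → R w (lower J y0) j ≡ true → (R w J j ∧ (Y j <ℚᵇ Y i)) ≡ true
    below-i j e = let (_ , _ , in-lower) = R⇒ {w} {lower J y0} e in
      ∧-intro (R-narrow (lower⊑ J y0) e)
              (to-yes (Y j ℚP.<? Y i) (ℚP.<-≤-trans (proj₂ (lower⇒ {J} in-lower)) y0≤Yi))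

  -- The upper child holds at most m segments: the lower child is non-empty and
  -- together they hold at most one more than the parent edge.
  upper-child-bound : ∀ {m w J y0} → SplitOK I T* (suc m) w J y0 →
                      count (R (suc w) J) ≤ m → count (R w (upper J y0)) ≤ m
  upper-child-bound {m} {w} {J} {y0} ((i , Ri , _ , Yi<y0) , _) parent = ℕP.≤-pred (begin
    1 + count (R w (upper J y0))                            ≤⟨ ℕP.+-monoˡ-≤ _ (count-positive i i-lower) ⟩
    count (R w (lower J y0)) + count (R w (upper J y0))     ≡⟨ R-split w J y0 ⟨
    count (R w J)                                           ≤⟨ R-step w J ⟩
    suc (count (R (suc w) J))                               ≤⟨ s≤s parent ⟩
    suc m                                                   ∎)
    where
    open ℕP.≤-Reasoning
    i-lower : R w (lower J y0) i ≡ true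
    i-lower = let (T*i , c , Ji) = R⇒ {w} {J} Ri in
      ⇒R w (lower J y0) T*i c (⇒lower {J} Ji (ycoord-nonneg I i) Yi<y0)

  -- The root edge r holds at most m segments, since edge r + 1 holds fewer than m.
  root-bound : ∀ {m r} → 1 ≤ m → (∀ w → r < w → w < n → count (R w (full I T*)) < m) →
               count (R r (full I T*)) ≤ m
  root-bound {m} {r} 1≤m sparse = ℕP.≤-trans (R-step r (full I T*)) (next (suc r ℕP.<? n))
    where
    next : Dec (suc r < n) → suc (count (R (suc r) (full I T*))) ≤ m
    next (yes r+1<n) = sparse (suc r) (ℕP.n<1+n r) r+1<n
    next (no r+1≮n) = subst (λ c → suc c ≤ m) (sym (R-off-path {suc r} {full I T*} r+1≮n)) 1≤m

  AllNodes-root : ∀ {k w J} {P : ℕ → Ival I T* → Set} (τ : Tree I T* k w J) → AllNodes I T* P τ → P w J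
  AllNodes-root leaf                p       = p
  AllNodes-root (one _ _)           (p , _) = p
  AllNodes-root (two _ _ _ _ _)     (p , _) = p

  last-edge : ∀ j → ∃ λ v → t j ≡ suc v × 1 ≤ v
  last-edge j with t j | s<t j | s-ge1 j
  ... | suc v | s≤s s≤v | 1≤s = v , refl , ℕP.≤-trans 1≤s s≤v

  hits⇒ : ∀ {x yb yt i} → hits I T* x yb yt i ≡ true →
          ℕ→ℚ 1 ℚ.< x × x ℚ.< ℕ→ℚ (t i) × yb ℚ.< Y i × Y i ℚ.< yt
  hits⇒ {x} {yb} {yt} {i} e =
    let (a , b , c , d) = split4 e in
    from-yes (ℕ→ℚ 1 ℚP.<? x) a , from-yes (x ℚP.<? ℕ→ℚ (t i)) b , from-yes (yb ℚP.<? Y i) c , from-yes (Y i ℚP.<? yt) d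
    where
    split4 : ∀ {a b c d} → a ∧ b ∧ c ∧ d ≡ true → a ≡ true × b ≡ true × c ≡ true × d ≡ true
    split4 {true} {true} {true} e = refl , refl , refl , e

  ⇒hits : ∀ {x yb yt i} → ℕ→ℚ 1 ℚ.< x → x ℚ.< ℕ→ℚ (t i) → yb ℚ.< Y i → Y i ℚ.< yt →
          hits I T* x yb yt i ≡ true
  ⇒hits {x} {yb} {yt} {i} a b c d =
    ∧-intro (to-yes (ℕ→ℚ 1 ℚP.<? x) a) (∧-intro (to-yes (x ℚP.<? ℕ→ℚ (t i)) b)
      (∧-intro (to-yes (yb ℚP.<? Y i) c) (to-yes (Y i ℚP.<? yt) d)))

  -- The window {x} × (yb,yt), for the tree parameter k = m + 1, the cover S'
  -- and the hit task j of least end vertex t(j) = v + 1.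
  module Window (m : ℕ) (S' : Fin N → Bool) (x yb yt : ℚ)
                (j : Fin N) (hit-j : hits I T* x yb yt j ≡ true)
                (j-first : ∀ i → (T* i ∧ hits I T* x yb yt i) ≡ true → t j ≤ t i)
                (v : ℕ) (tj≡v+1 : t j ≡ suc v) (1≤v : 1 ≤ v) where

    k : ℕ
    k = suc m

    H : Fin N → Bool
    H i = T* i ∧ hits I T* x yb yt i

    HitIn : Ival I T* → Fin N → Bool
    HitIn J i = H i ∧ J (Y i)

    Success : Set
    Success = ∃ λ i → S' i ≡ true × hits I T* x yb yt i ≡ true

    Covered : ℕ → Ival I T* → Set
    Covered w J = ∃ λ i → S' i ≡ true × R w J i ≡ true

    v<n : v < n
    v<n = subst (_≤ n) tj≡v+1 (t-le-n j)

    reaches : ∀ {i} → H i ≡ true → suc v ≤ t i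
    reaches {i} Hi = subst (_≤ t i) tj≡v+1 (j-first i Hi)

    x-before : ∀ {i} → suc v ≤ t i → x ℚ.< ℕ→ℚ (t i)
    x-before {i} v<t = ℚP.<-≤-trans {x} {ℕ→ℚ (t j)} {ℕ→ℚ (t i)} x<tj (ℕ→ℚ-mono (subst (_≤ t i) (sym tj≡v+1) v<t))
      where
      x<tj : x ℚ.< ℕ→ℚ (t j)
      x<tj = proj₁ (proj₂ (hits⇒ {x} {yb} {yt} {j} hit-j))

    HitIn⇒R : ∀ {J i} → HitIn J i ≡ true → R v J i ≡ true
    HitIn⇒R {J} {i} e = let (Hi , Ji) = ∧-elim {H i} e in
      ⇒R v J (proj₁ (∧-elim {T* i} Hi)) (⇒contains 1≤v (reaches Hi)) Ji

    inside : ∀ {i} → H i ≡ true → yb ℚ.< Y i × Y i ℚ.< yt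
    inside {i} Hi = let (_ , _ , yb<y , y<yt) = hits⇒ {x} {yb} {yt} {i} (proj₂ (∧-elim {T* i} Hi)) in yb<y , y<yt

    missed-outside : ∀ {i} → suc v ≤ t i → hits I T* x yb yt i ≡ false → Y i ℚ.≤ yb ⊎ yt ℚ.≤ Y i
    missed-outside {i} v<t missed = by-position (yb ℚP.<? Y i) (Y i ℚP.<? yt)
      where
      by-position : Dec (yb ℚ.< Y i) → Dec (Y i ℚ.< yt) → Y i ℚ.≤ yb ⊎ yt ℚ.≤ Y i
      by-position (no yb≮y)  _          = inj₁ (ℚP.≮⇒≥ yb≮y)
      by-position (yes _)    (no y≮yt)  = inj₂ (ℚP.≮⇒≥ y≮yt)
      by-position (yes yb<y) (yes y<yt) =
        false≢true missed (⇒hits {x} {yb} {yt} {i} (proj₁ (hits⇒ {x} {yb} {yt} {j} hit-j)) (x-before v<t) yb<y y<yt)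

    Meets Below Above : Ival I T* → Set
    Meets J = ∃ λ i → HitIn J i ≡ true
    Below J = ∃ λ i → R v J i ≡ true × Y i ℚ.≤ yb
    Above J = ∃ λ i → R v J i ≡ true × yt ℚ.≤ Y i

    Meets-widen : ∀ {J' J} → J' ⊑ J → Meets J' → Meets J
    Meets-widen {J'} J'⊑J (i , e) = let (Hi , J'i) = ∧-elim {H i} {J' (Y i)} e in i , ∧-intro Hi (J'⊑J (Y i) J'i)

    Below-widen : ∀ {J' J} → J' ⊑ J → Below J' → Below J
    Below-widen {J'} {J} J'⊑J (i , Ri , low) = i , R-narrow {v} {J'} {J} J'⊑J Ri , low

    Above-widen : ∀ {J' J} → J' ⊑ J → Above J' → Above J
    Above-widen {J'} {J} J'⊑J (i , Ri , high) = i , R-narrow {v} {J'} {J} J'⊑J Ri , high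

    low-gap : ∀ J y0 → Meets (lower J y0) → Below (upper J y0) → ⊥
    low-gap J y0 (h , e) (l , Rl , Yl≤yb) = ℚP.<-irrefl refl (begin-strict
      yb    <⟨ proj₁ (inside Hh) ⟩
      Y h   <⟨ proj₂ (lower⇒ {J} in-lower) ⟩
      y0    ≤⟨ proj₂ (upper⇒ {J} (proj₂ (proj₂ (R⇒ {v} {upper J y0} Rl)))) ⟩
      Y l   ≤⟨ Yl≤yb ⟩
      yb    ∎)
      where
      open ℚP.≤-Reasoning
      Hh : H h ≡ true
      Hh = proj₁ (∧-elim {H h} e)
      in-lower : lower J y0 (Y h) ≡ true
      in-lower = proj₂ (∧-elim {H h} e)

    high-gap : ∀ J y0 → Above (lower J y0) → Meets (upper J y0) → ⊥
    high-gap J y0 (u , Ru , yt≤Yu) (h , e) = ℚP.<-irrefl refl (begin-strict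
      yt    ≤⟨ yt≤Yu ⟩
      Y u   <⟨ proj₂ (lower⇒ {J} (proj₂ (proj₂ (R⇒ {v} {lower J y0} Ru)))) ⟩
      y0    ≤⟨ proj₂ (upper⇒ {J} in-upper) ⟩
      Y h   <⟨ proj₂ (inside Hh) ⟩
      yt    ∎)
      where
      open ℚP.≤-Reasoning
      Hh : H h ≡ true
      Hh = proj₁ (∧-elim {H h} e)
      in-upper : upper J y0 (Y h) ≡ true
      in-upper = proj₂ (∧-elim {H h} e)

    -- The invariant of the induction: the hits with height in J number at most
    -- m · (low + high), where low / high certify a segment of R_v J below / above
    -- the window sharing J with a hit.
    record Confined (J : Ival I T*) : Set where
      field
        low high  : Bool
        low-ok    : low ≡ true → Meets J × Below J
        high-ok   : high ≡ true → Meets J × Above J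
        few       : count (HitIn J) ≤ m * (ind low + ind high)

    -- A node at edge v: either its cover element is hit, or it lies outside the
    -- window and certifies the one side on which all (≤ m) hits in J are bounded.
    at-v : ∀ {J} → count (R v J) ≤ m → Covered v J → Success ⊎ Confined J
    at-v {J} bound (i , S'i , Ri) = by-hit (hits I T* x yb yt i) refl
      where
      few-one : count (HitIn J) ≤ m * 1
      few-one = ℕP.≤-trans (count-mono {f = HitIn J} {g = R v J} (λ i → HitIn⇒R {J} {i}))
                           (ℕP.≤-trans bound (ℕP.≤-reflexive (sym (ℕP.*-identityʳ m))))
      one-sided : count (HitIn J) ≡ 0 ⊎ Meets J → Y i ℚ.≤ yb ⊎ yt ℚ.≤ Y i → Confined J
      one-sided (inj₁ none)  _ =
        record { low = false ; high = false ; low-ok = λ () ; high-ok = λ () ; few = ℕP.≤-trans (ℕP.≤-reflexive none) z≤n }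
      one-sided (inj₂ meets) (inj₁ below) =
        record { low = true ; high = false ; low-ok = λ _ → meets , (i , Ri , below) ; high-ok = λ () ; few = few-one }
      one-sided (inj₂ meets) (inj₂ above) =
        record { low = false ; high = true ; low-ok = λ () ; high-ok = λ _ → meets , (i , Ri , above) ; few = few-one }
      by-hit : ∀ b → hits I T* x yb yt i ≡ b → Success ⊎ Confined J
      by-hit true  hit    = inj₁ (i , S'i , hit)
      by-hit false missed = inj₂ (one-sided (count-zero-or-witness (HitIn J))
                                            (missed-outside (proj₂ (contains⇒ (proj₁ (proj₂ (R⇒ {v} {J} Ri))))) missed))

    HitIn-split : ∀ J y0 → count (HitIn J) ≡ count (HitIn (lower J y0)) + count (HitIn (upper J y0))
    HitIn-split J y0 = count-additive λ i → ind-∧-split (H i) (interval-split J y0 (Y i) (ycoord-nonneg I i))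

    -- Confinement of both halves of a split gives confinement of the whole interval:
    -- by the gap lemmas each side is certified by at most one of the halves.
    merge : ∀ J y0 → Confined (lower J y0) → Confined (upper J y0) → Confined J
    merge J y0 cb ca = record
      { low     = B.low ∨ A.low
      ; high    = B.high ∨ A.high
      ; low-ok  = λ e → [ (λ l → widen-low (lower J y0) (lower⊑ J y0) (B.low-ok l))
                        , (λ l → widen-low (upper J y0) (upper⊑ J y0) (A.low-ok l)) ] (∨-elim e)
      ; high-ok = λ e → [ (λ h → widen-high (lower J y0) (lower⊑ J y0) (B.high-ok h))
                        , (λ h → widen-high (upper J y0) (upper⊑ J y0) (A.high-ok h)) ] (∨-elim e)
      ; few     = begin
          count (HitIn J)                                             ≡⟨ HitIn-split J y0 ⟩
          count (HitIn (lower J y0)) + count (HitIn (upper J y0))     ≤⟨ ℕP.+-mono-≤ B.few A.few ⟩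
          m * (ind B.low + ind B.high) + m * (ind A.low + ind A.high) ≡⟨ ℕP.*-distribˡ-+ m (ind B.low + ind B.high) _ ⟨
          m * ((ind B.low + ind B.high) + (ind A.low + ind A.high))   ≡⟨ cong (m *_) (interchange (ind B.low) _ _ _) ⟩
          m * ((ind B.low + ind A.low) + (ind B.high + ind A.high))   ≡⟨ cong (m *_) (cong₂ _+_
                                                                            (ind-∨-disjoint B.low A.low low-clash)
                                                                            (ind-∨-disjoint B.high A.high high-clash)) ⟩
          m * (ind (B.low ∨ A.low) + ind (B.high ∨ A.high))           ∎
      }
      where
      open ℕP.≤-Reasoning
      module B = Confined cb
      module A = Confined ca
      widen-low : ∀ J' → J' ⊑ J → Meets J' × Below J' → Meets J × Below J
      widen-low J' J'⊑J (meets , below) = Meets-widen {J'} {J} J'⊑J meets , Below-widen {J'} {J} J'⊑J below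
      widen-high : ∀ J' → J' ⊑ J → Meets J' × Above J' → Meets J × Above J
      widen-high J' J'⊑J (meets , above) = Meets-widen {J'} {J} J'⊑J meets , Above-widen {J'} {J} J'⊑J above
      low-clash : B.low ≡ true → A.low ≡ true → ⊥
      low-clash lb la = low-gap J y0 (proj₁ (B.low-ok lb)) (proj₂ (A.low-ok la))
      high-clash : B.high ≡ true → A.high ≡ true → ⊥
      high-clash hb ha = high-gap J y0 (proj₂ (B.high-ok hb)) (proj₁ (A.high-ok ha))

    merge-results : ∀ J y0 → Success ⊎ Confined (lower J y0) → Success ⊎ Confined (upper J y0) → Success ⊎ Confined J
    merge-results J y0 (inj₁ hit) _          = inj₁ hit
    merge-results J y0 (inj₂ _)   (inj₁ hit) = inj₁ hit
    merge-results J y0 (inj₂ cb)  (inj₂ ca)  = inj₂ (merge J y0 cb ca)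

    -- The induction on a covered subtree whose root edge w lies at or right of v
    -- and carries at most m segments; the decision records whether w = v.
    descend : ∀ {w J} (τ : Tree I T* k w J) → Dec (v ≡ w) → v ≤ w → count (R w J) ≤ m →
              AllNodes I T* Covered τ → Success ⊎ Confined J
    descend τ (yes refl) _ bound cover = at-v bound (AllNodes-root τ cover)
    descend leaf (no v≢1) v≤1 _ _ = ⊥-elim (v≢1 (ℕP.≤-antisym v≤1 1≤v))
    descend (one {w} sparse τ) (no v≢w+1) v≤w+1 _ (_ , cover) =
      descend τ (v ℕP.≟ w) (ℕP.≤-pred (ℕP.≤∧≢⇒< v≤w+1 v≢w+1)) (ℕP.≤-pred sparse) cover
    descend (two {w} {J} y0 _ split τb τa) (no v≢w+1) v≤w+1 bound (_ , cover-b , cover-a) =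
      merge-results J y0 (descend τb (v ℕP.≟ w) v≤w (lower-child-bound {m} {w} {J} {y0} split) cover-b)
                         (descend τa (v ℕP.≟ w) v≤w (upper-child-bound {m} {w} {J} {y0} split bound) cover-a)
      where v≤w = ℕP.≤-pred (ℕP.≤∧≢⇒< v≤w+1 v≢w+1)

    H⇒HitIn-full : ∀ {i} → H i ≡ true → HitIn (full I T*) i ≡ true
    H⇒HitIn-full {i} Hi = ∧-intro Hi (to-yes (0ℚ ℚP.≤? Y i) (ycoord-nonneg I i))

    few-if-sparse : count (R v (full I T*)) < m → count H ≤ 2 * m
    few-if-sparse sparse = begin
      count H                   ≤⟨ count-mono (λ i Hi → HitIn⇒R {full I T*} {i} (H⇒HitIn-full Hi)) ⟩
      count (R v (full I T*))   ≤⟨ ℕP.<⇒≤ sparse ⟩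
      m                         ≤⟨ ℕP.m≤m+n m (m + 0) ⟩
      2 * m                     ∎
      where open ℕP.≤-Reasoning

    few-if-confined : Confined (full I T*) → count H ≤ 2 * m
    few-if-confined confined = begin
      count H                             ≤⟨ count-mono (λ i → H⇒HitIn-full {i}) ⟩
      count (HitIn (full I T*))           ≤⟨ few ⟩
      m * (ind low + ind high)            ≤⟨ ℕP.*-monoʳ-≤ m (ℕP.+-mono-≤ (ind≤1 low) (ind≤1 high)) ⟩
      m * 2                               ≡⟨ ℕP.*-comm m 2 ⟩
      2 * m                               ∎
      where
      open ℕP.≤-Reasoning
      open Confined confined

    window-bound : 1 ≤ m → (𝒟 : TreeD I T* k) → SegmentCover I T* 𝒟 S' → Success ⊎ count H ≤ 2 * m
    window-bound _   (noNodes sparse) _ = inj₂ (few-if-sparse (sparse v 1≤v v<n))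
    window-bound 1≤m (rooted r _ _ _ sparse τ) cover = from-root (r ℕP.<? v)
      where
      from-root : Dec (r < v) → Success ⊎ count H ≤ 2 * m
      from-root (yes r<v) = inj₂ (few-if-sparse (sparse v r<v v<n))
      from-root (no r≮v)  = map₂ few-if-confined
        (descend τ (v ℕP.≟ r) (ℕP.≮⇒≥ r≮v) (root-bound 1≤m sparse) cover)

  cover⇒thin : ∀ m → 1 ≤ m → (𝒟 : TreeD I T* (suc m)) (S' : Fin N → Bool) →
               SegmentCover I T* 𝒟 S' → Thin I T* (2 * suc m) S'
  cover⇒thin m 1≤m 𝒟 S' cover x yb yt many = from-first (minimiser hit t)
    where
    hit : Fin N → Bool
    hit i = T* i ∧ hits I T* x yb yt i
    too-many : count hit ≤ 2 * m → ⊥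
    too-many few = ℕP.<-irrefl refl (ℕP.≤-trans many (ℕP.≤-trans few (ℕP.*-monoʳ-≤ 2 (ℕP.n≤1+n m))))
    from-first : (∃ λ j → hit j ≡ true × (∀ i → hit i ≡ true → t j ≤ t i)) ⊎ (∀ i → hit i ≡ false) →
                 ∃ λ i → S' i ≡ true × hits I T* x yb yt i ≡ true
    from-first (inj₂ no-hit) = ⊥-elim (too-many (ℕP.≤-trans (ℕP.≤-reflexive (count-none no-hit)) z≤n))
    from-first (inj₁ (j , hit-j , j-first)) =
      let (v , tj≡v+1 , 1≤v) = last-edge j
          open Window m S' x yb yt j (proj₂ (∧-elim {T* j} hit-j)) j-first v tj≡v+1 1≤v
      in  [ id , (λ few → ⊥-elim (too-many few)) ] (window-bound 1≤m 𝒟 cover)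

lemma13 : (I : UFP) → Standing I →
    (T* : Fin (UFP.N I) → Bool) → Optimal I T* →
    (k : ℕ) → 2 ≤ k → ∃ (λ h → k ≡ 2 * h) →
    (𝒟 : TreeD I T* k) →
    (S' : Fin (UFP.N I) → Bool) → (∀ i → S' i ≡ true → T* i ≡ true) →
    SegmentCover I T* 𝒟 S' →
    Thin I T* (2 * k) S'
lemma13 I std T* _ (suc (suc m)) _ _ 𝒟 S' _ cover =
  Geometry.cover⇒thin I std T* (suc m) (s≤s z≤n) 𝒟 S' cover
lemma13 _ _ _ _ (suc zero) (s≤s ()) _ _ _ _ _
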